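{- Let $\lambda\ge2$ be an integer and let $\mathbf{vtm}_\lambda$ be the fixed point starting with $0$ of the morphism $f_\lambda:0\mapsto01\lambda$, $1\mapsto0\lambda$, $\lambda\mapsto1$ over the alphabet $\{0,1,\lambda\}$. If $\lambda\ge5$, then $\rho^{\mathrm{add}}_{\mathbf{vtm}_\lambda}(n)=\rho^{\mathrm{ab}}_{\mathbf{vtm}_\lambda}(n)$ for all $n\ge0$.
   Context: Letters $0,1,\lambda$ are regarded as integers. For a word $w$, $|w|_a$ counts occurrences of $a$. Words $u,v$ are abelian equivalent if $|u|_a=|v|_a$ for all letters $a$, and additively equivalent if $|u|=|v|$ and $|u|_1+\lambda|u|_\lambda=|v|_1+\lambda|v|_\lambda$. $\rho^{\mathrm{ab}}_{\mathbf{x}}(n)$ (resp. $\rho^{\mathrm{add}}_{\mathbf{x}}(n)$) is the number of abelian (resp. additive) equivalence classes of length-$n$ factors of $\mathbf{x}$. -}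

module Defs where

open import Data.Nat using (ℕ; zero; suc; _+_; _*_)
open import Data.List using (List; []; _∷_; _++_; concatMap; length; map; sum)
open import Data.Fin using (Fin)
open import Data.Product using (Σ; _×_; _,_)
open import Relation.Binary.PropositionalEquality using (_≡_)
open import Relation.Nullary using (¬_)

-- The alphabet {0, 1, λ}; ℓ stands for the letter λ.
data Letter : Set where
  l0 l1 ℓ : Letter

val : ℕ → Letter → ℕ
val lam l0 = 0
val lam l1 = 1
val lam ℓ  = lam

f : Letter → List Letter
f l0 = l0 ∷ l1 ∷ ℓ ∷ []
f l1 = l0 ∷ ℓ ∷ []
f ℓ  = l1 ∷ []

fWord : List Letter → List Letter
fWord = concatMap f

iter : ℕ → List Letter
iter zero    = l0 ∷ []
iter (suc k) = fWord (iter k)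

-- i-th letter of a list (default l0 if out of range; never used out of range below)
nth : List Letter → ℕ → Letter
nth []       _       = l0
nth (a ∷ w)  zero    = a
nth (a ∷ w)  (suc i) = nth w i

-- the fixed point vtm_λ of f_λ starting with 0:  since |f^k(0)| ≥ k+1 and
-- f^k(0) is a prefix of f^(k+1)(0), its i-th letter is the i-th letter of f^(i+1)(0).
vtm : ℕ → Letter
vtm i = nth (iter (suc i)) i

factor : (ℕ → Letter) → ℕ → ℕ → List Letter
factor x i zero    = []
factor x i (suc n) = x i ∷ factor x (suc i) n

count : Letter → List Letter → ℕ
count a [] = 0
count l0 (l0 ∷ w) = suc (count l0 w)
count l1 (l1 ∷ w) = suc (count l1 w)
count ℓ  (ℓ ∷ w)  = suc (count ℓ w)
count a  (_ ∷ w)  = count a w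

AbEq : List Letter → List Letter → Set
AbEq u v = (a : Letter) → count a u ≡ count a v

AddEq : ℕ → List Letter → List Letter → Set
AddEq lam u v = (length u ≡ length v) ×
  (count l1 u + lam * count ℓ u ≡ count l1 v + lam * count ℓ v)

-- "the length-n factors of x fall into exactly k classes of the relation R":
-- there are k starting positions whose length-n factors are pairwise
-- R-inequivalent, and every length-n factor of x is R-equivalent to one of them.
NumClasses : (List Letter → List Letter → Set) → (ℕ → Letter) → ℕ → ℕ → Set
NumClasses R x n k =
  Σ (Fin k → ℕ) λ pos →
    ((p q : Fin k) → R (factor x (pos p) n) (factor x (pos q) n) → p ≡ q) ×
    ((i : ℕ) → Σ (Fin k) λ p → R (factor x i n) (factor x (pos p) n))

-- In f_λ(w) the letters 0 and λ alternate, starting with 0, so in every factor of vtm_λ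
-- the numbers of 0s and λs differ by at most 1. If two factors of the same length and the
-- same additive weight have c and c + d letters λ, the two equations force their numbers of
-- 0s to differ by (λ - 1)d, whereas balance bounds that difference by d + 2; for λ ≥ 5 this
-- gives d = 0, so additive and abelian equivalence coincide on factors.
--
-- To count classes constructively, every factor of length n must be found in the finite
-- prefix f^(2n+3)(0). Every f²-image of a letter has length at least 2, so a factor of
-- length at least 3 of f²(w) lies in the f²-image of a strictly shorter factor of w; the
-- factors of length at most 2 are letters and pairs of distinct letters, all of which
-- occur in f³(0).

module Submission where

open import Defs
open import Data.Nat using (ℕ; zero; suc; _+_; _*_; _≤_; _<_; z≤n; s≤s; z<s; _≟_; _≤?_)
open import Data.Nat.Properties
open import Data.Nat.Tactic.RingSolver using (solve-∀)
open import Data.Fin using (Fin; zero; suc)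
open import Data.Fin.Properties using (any?)
open import Data.List using (List; []; _∷_; _++_; length; concatMap)
open import Data.List.Properties using (++-assoc; ++-identityʳ; length-++; length-++-≤ˡ; concatMap-++; ∷-injective)
open import Data.List.Relation.Unary.Linked as Linked using (Linked; []; [-]; _∷_)
open import Data.Product using (Σ; Σ-syntax; ∃-syntax; _×_; _,_; proj₂; map₂; swap)
open import Data.Sum using (_⊎_; inj₁; inj₂)
open import Data.Empty using (⊥; ⊥-elim)
open import Function using (_∘_)
open import Relation.Nullary using (Dec; yes; no)
open import Relation.Binary.PropositionalEquality

module _ {A : Set} where

  Prefix : List A → List A → Set
  Prefix u w = ∃[ s ] w ≡ u ++ s

  Infix : List A → List A → Set
  Infix u w = ∃[ p ] ∃[ s ] w ≡ p ++ u ++ s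

  Prefix⇒Infix : ∀ {u w} → Prefix u w → Infix u w
  Prefix⇒Infix (s , e) = [] , s , e

  Infix-∷ : ∀ {u w} a → Infix u w → Infix u (a ∷ w)
  Infix-∷ a (p , s , e) = a ∷ p , s , cong (a ∷_) e

  Infix-++ʳ : ∀ {u w} t → Infix u w → Infix u (w ++ t)
  Infix-++ʳ {u} t (p , s , refl) = p , s ++ t , trans (++-assoc p (u ++ s) t) (cong (p ++_) (++-assoc u s t))

  Infix-trans : ∀ {u v w} → Infix u v → Infix v w → Infix u w
  Infix-trans {u} (p , s , refl) (p′ , s′ , refl) = p′ ++ p , s ++ s′ , regroup
    where
    open ≡-Reasoning
    regroup : p′ ++ (p ++ u ++ s) ++ s′ ≡ (p′ ++ p) ++ u ++ s ++ s′
    regroup = begin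
      p′ ++ (p ++ u ++ s) ++ s′   ≡⟨ cong (p′ ++_) (++-assoc p (u ++ s) s′) ⟩
      p′ ++ p ++ (u ++ s) ++ s′   ≡⟨ cong (λ z → p′ ++ p ++ z) (++-assoc u s s′) ⟩
      p′ ++ p ++ u ++ s ++ s′     ≡⟨ ++-assoc p′ p (u ++ s ++ s′) ⟨
      (p′ ++ p) ++ u ++ s ++ s′   ∎

  length-Infix-offset : ∀ (p u s : List A) → length p + length u ≤ length (p ++ u ++ s)
  length-Infix-offset p u s = begin
    length p + length u              ≤⟨ +-monoʳ-≤ (length p) (m≤m+n (length u) (length s)) ⟩
    length p + (length u + length s) ≡⟨ cong (length p +_) (length-++ u) ⟨
    length p + length (u ++ s)       ≡⟨ length-++ p ⟨
    length (p ++ u ++ s)             ∎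
    where open ≤-Reasoning

  ++-split : ∀ (x y u s : List A) → x ++ y ≡ u ++ s →
             (∃[ r ] x ≡ u ++ r × s ≡ r ++ y) ⊎ (∃[ r ] u ≡ x ++ r × y ≡ r ++ s)
  ++-split []      y u       s e = inj₂ (u , refl , e)
  ++-split (a ∷ x) y []      s e = inj₁ (a ∷ x , refl , sym e)
  ++-split (a ∷ x) y (b ∷ u) s e with ∷-injective e
  ... | refl , e′ with ++-split x y u s e′
  ...   | inj₁ (r , ex , es) = inj₁ (r , cong (a ∷_) ex , es)
  ...   | inj₂ (r , eu , ey) = inj₂ (r , cong (a ∷_) eu , ey)

module _ {A B : Set} (σ : A → List B) where

  concatMap-Prefix : ∀ {u w} → Prefix u w → Prefix (concatMap σ u) (concatMap σ w)
  concatMap-Prefix {u} (s , refl) = concatMap σ s , concatMap-++ σ u s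

  concatMap-Infix : ∀ {u w} → Infix u w → Infix (concatMap σ u) (concatMap σ w)
  concatMap-Infix {u} (p , s , refl) = concatMap σ p , concatMap σ s ,
    trans (concatMap-++ σ p (u ++ s)) (cong (concatMap σ p ++_) (concatMap-++ σ u s))

  concatMap-concatMap : ∀ {C : Set} (τ : C → List A) w →
                        concatMap σ (concatMap τ w) ≡ concatMap (concatMap σ ∘ τ) w
  concatMap-concatMap τ []      = refl
  concatMap-concatMap τ (a ∷ w) = trans (concatMap-++ σ (τ a) (concatMap τ w))
    (cong (concatMap σ (τ a) ++_) (concatMap-concatMap τ w))

module Desubstitution {A B : Set} (σ : A → List B) (σ-long : ∀ a → 2 ≤ length (σ a)) where

  prefix-cover : ∀ W u s → concatMap σ W ≡ u ++ s →
    ∃[ v ] Prefix v W × Prefix u (concatMap σ v) × 2 * length v ≤ suc (length u)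
  prefix-cover W       []      s e = [] , (W , refl) , ([] , refl) , z≤n
  prefix-cover []      (x ∷ u) s ()
  prefix-cover (a ∷ W) (x ∷ u) s e with ++-split (σ a) (concatMap σ W) (x ∷ u) s e
  ... | inj₁ (r , ea , _) = a ∷ [] , (W , refl) , (r , trans (++-identityʳ (σ a)) ea) , s≤s (s≤s z≤n)
  ... | inj₂ (r , eu , eW) with prefix-cover W r s eW
  ...   | v , (t , eV) , (t′ , ev) , bound = a ∷ v , (t , cong (a ∷_) eV) , (t′ , cover) , grows
    where
    cover : σ a ++ concatMap σ v ≡ (x ∷ u) ++ t′
    cover = trans (cong (σ a ++_) ev) (trans (sym (++-assoc (σ a) r t′)) (cong (_++ t′) (sym eu)))
    grows : 2 * suc (length v) ≤ suc (length (x ∷ u))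
    grows = begin
      2 * suc (length v)            ≡⟨ *-suc 2 (length v) ⟩
      2 + 2 * length v              ≤⟨ +-mono-≤ (σ-long a) bound ⟩
      length (σ a) + suc (length r) ≡⟨ +-suc (length (σ a)) (length r) ⟩
      suc (length (σ a) + length r) ≡⟨ cong suc (length-++ (σ a)) ⟨
      suc (length (σ a ++ r))       ≡⟨ cong (suc ∘ length) eu ⟨
      suc (length (x ∷ u))          ∎
      where open ≤-Reasoning

  infix-cover : ∀ W p u s → concatMap σ W ≡ p ++ u ++ s →
    ∃[ v ] Infix v W × Infix u (concatMap σ v) × 2 * length v ≤ length u + 2
  infix-cover W       p       []      s e = [] , ([] , W , refl) , ([] , [] , refl) , z≤n
  infix-cover []      []      (x ∷ u) s ()
  infix-cover []      (_ ∷ _) (x ∷ u) s ()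
  infix-cover (a ∷ W) p       (x ∷ u) s e with ++-split (σ a) (concatMap σ W) p ((x ∷ u) ++ s) e
  ... | inj₂ (r , _ , eW)  = map₂ (λ (iv , rest) → Infix-∷ a iv , rest) (infix-cover W r (x ∷ u) s eW)
  -- u starts exactly where σ a ends
  ... | inj₁ ([] , _ , eW) = map₂ (λ (iv , rest) → Infix-∷ a iv , rest) (infix-cover W [] (x ∷ u) s (sym eW))
  ... | inj₁ (r@(_ ∷ _) , ea , eus) with ++-split r (concatMap σ W) (x ∷ u) s (sym eus)
  ...   | inj₁ (r′ , er , _) =
          a ∷ [] , ([] , W , refl) , Infix-++ʳ [] (p , r′ , trans ea (cong (p ++_) er)) , m≤n+m 2 (length (x ∷ u))
  ...   | inj₂ (u″ , eu , eW) with prefix-cover W u″ s eW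
  ...     | v , (t , eV) , (t′ , ev) , bound = a ∷ v , ([] , t , cong (a ∷_) eV) , (p , t′ , cover) , grows
    where
    cover : σ a ++ concatMap σ v ≡ p ++ (x ∷ u) ++ t′
    cover = begin
      σ a ++ concatMap σ v  ≡⟨ cong₂ _++_ ea ev ⟩
      (p ++ r) ++ u″ ++ t′  ≡⟨ ++-assoc p r (u″ ++ t′) ⟩
      p ++ r ++ u″ ++ t′    ≡⟨ cong (p ++_) (++-assoc r u″ t′) ⟨
      p ++ (r ++ u″) ++ t′  ≡⟨ cong (λ z → p ++ z ++ t′) eu ⟨
      p ++ (x ∷ u) ++ t′    ∎
      where open ≡-Reasoning
    grows : 2 * suc (length v) ≤ length (x ∷ u) + 2
    grows = begin
      2 * suc (length v)         ≡⟨ *-suc 2 (length v) ⟩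
      2 + 2 * length v           ≤⟨ +-monoʳ-≤ 2 bound ⟩
      2 + suc (length u″)        ≤⟨ +-monoʳ-≤ 2 (+-monoˡ-≤ (length u″) (s≤s z≤n)) ⟩
      2 + (length r + length u″) ≡⟨ +-comm 2 _ ⟩
      length r + length u″ + 2   ≡⟨ cong (_+ 2) (length-++ r) ⟨
      length (r ++ u″) + 2       ≡⟨ cong (λ z → length z + 2) eu ⟨
      length (x ∷ u) + 2         ∎
      where open ≤-Reasoning

fWord-Infix : ∀ {u w} → Infix u w → Infix (fWord u) (fWord w)
fWord-Infix = concatMap-Infix f

length-fWord : ∀ w → length w ≤ length (fWord w)
length-fWord []       = z≤n
length-fWord (l0 ∷ w) = s≤s (m≤n⇒m≤1+n (m≤n⇒m≤1+n (length-fWord w)))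
length-fWord (l1 ∷ w) = s≤s (m≤n⇒m≤1+n (length-fWord w))
length-fWord (ℓ ∷ w)  = s≤s (length-fWord w)

iter-starts-with-0 : ∀ K → ∃[ t ] iter K ≡ l0 ∷ t × K ≤ length t
iter-starts-with-0 zero = [] , refl , z≤n
iter-starts-with-0 (suc K) with iter-starts-with-0 K
... | t , e , K≤ = l1 ∷ ℓ ∷ fWord t , cong fWord e ,
                   s≤s (m≤n⇒m≤1+n (≤-trans K≤ (length-fWord t)))

length-iter : ∀ K → K < length (iter K)
length-iter K with iter-starts-with-0 K
... | t , e , K≤ = subst (λ w → K < length w) (sym e) (s≤s K≤)

iter-Prefix : ∀ {K K′} → K ≤ K′ → Prefix (iter K) (iter K′)
iter-Prefix {K′ = K′} z≤n with iter-starts-with-0 K′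
... | t , e , _ = t , e
iter-Prefix (s≤s K≤K′) = concatMap-Prefix f (iter-Prefix K≤K′)

nth-Prefix : ∀ {u w} j → Prefix u w → j < length u → nth w j ≡ nth u j
nth-Prefix {a ∷ u} zero    (s , refl) _          = refl
nth-Prefix {a ∷ u} (suc j) (s , refl) (s≤s j<u) = nth-Prefix {u} j (s , refl) j<u

vtm-nth-iter : ∀ K j → j < length (iter K) → vtm j ≡ nth (iter K) j
vtm-nth-iter K j j<iterK = begin
  nth (iter (suc j)) j      ≡⟨ nth-Prefix j (iter-Prefix (m≤n+m (suc j) K)) (<⇒≤ (length-iter (suc j))) ⟨
  nth (iter (K + suc j)) j  ≡⟨ nth-Prefix j (iter-Prefix (m≤m+n K (suc j))) j<iterK ⟩
  nth (iter K) j            ∎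
  where open ≡-Reasoning

factor-cong : ∀ {x y} i n → (∀ j → j < i + n → x j ≡ y j) → factor x i n ≡ factor y i n
factor-cong i zero    x≗y = refl
factor-cong i (suc n) x≗y = cong₂ _∷_ (x≗y i (m<m+n i z<s))
  (factor-cong (suc i) n (λ j j< → x≗y j (subst (j <_) (sym (+-suc i n)) j<)))

length-factor : ∀ x i n → length (factor x i n) ≡ n
length-factor x i zero    = refl
length-factor x i (suc n) = cong suc (length-factor x (suc i) n)

factor-nth-∷ : ∀ a w i n → factor (nth (a ∷ w)) (suc i) n ≡ factor (nth w) i n
factor-nth-∷ a w i zero    = refl
factor-nth-∷ a w i (suc n) = cong (nth w i ∷_) (factor-nth-∷ a w (suc i) n)

factor-nth-Prefix : ∀ w n → n ≤ length w → Prefix (factor (nth w) 0 n) w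
factor-nth-Prefix w       zero    _       = w , refl
factor-nth-Prefix (a ∷ w) (suc n) (s≤s n≤w) with factor-nth-Prefix w n n≤w
... | s , e = s , cong (a ∷_) (trans e (cong (_++ s) (sym (factor-nth-∷ a w zero n))))

factor-nth-Infix : ∀ w i n → i + n ≤ length w → Infix (factor (nth w) i n) w
factor-nth-Infix w       zero    n i+n≤w = Prefix⇒Infix (factor-nth-Prefix w n i+n≤w)
factor-nth-Infix (a ∷ w) (suc i) n (s≤s i+n≤w) =
  subst (λ u → Infix u (a ∷ w)) (sym (factor-nth-∷ a w i n)) (Infix-∷ a (factor-nth-Infix w i n i+n≤w))

factor-nth-++ : ∀ p u s → factor (nth (p ++ u ++ s)) (length p) (length u) ≡ u
factor-nth-++ (a ∷ p) u s = trans (factor-nth-∷ a (p ++ u ++ s) (length p) (length u)) (factor-nth-++ p u s)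
factor-nth-++ []      []      s = refl
factor-nth-++ []      (a ∷ u) s = cong (a ∷_) (trans (factor-nth-∷ a (u ++ s) 0 (length u)) (factor-nth-++ [] u s))

vtm-factor-Infix : ∀ K i n → i + n ≤ length (iter K) → Infix (factor vtm i n) (iter K)
vtm-factor-Infix K i n i+n≤ = subst (λ u → Infix u (iter K))
  (factor-cong i n (λ j j< → sym (vtm-nth-iter K j (<-≤-trans j< i+n≤))))
  (factor-nth-Infix (iter K) i n i+n≤)

vtm-factor-in-iter : ∀ i n → Infix (factor vtm i n) (iter (suc (i + n)))
vtm-factor-in-iter i n = vtm-factor-Infix (suc (i + n)) i n (<⇒≤ (<-trans (n<1+n (i + n)) (length-iter _)))

Infix-iter⇒vtm-factor : ∀ {u K} → Infix u (iter K) →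
                        ∃[ j ] j ≤ length (iter K) × factor vtm j (length u) ≡ u
Infix-iter⇒vtm-factor {u} {K} (p , s , e) =
  length p , ≤-trans (length-++-≤ˡ p) (≤-reflexive (cong length (sym e))) ,
  trans (factor-cong (length p) (length u) (λ j j< → vtm-nth-iter K j (<-≤-trans j< offset)))
        (subst (λ w → factor (nth w) (length p) (length u) ≡ u) (sym e) (factor-nth-++ p u s))
  where
  offset : length p + length u ≤ length (iter K)
  offset = subst (λ w → length p + length u ≤ length w) (sym e) (length-Infix-offset p u s)

fWord²-square-free : ∀ w → Linked _≢_ (fWord (fWord w))
fWord²-square-free []             = []
fWord²-square-free (l0 ∷ [])      = (λ ()) ∷ (λ ()) ∷ (λ ()) ∷ (λ ()) ∷ (λ ()) ∷ [-]
fWord²-square-free (l1 ∷ [])      = (λ ()) ∷ (λ ()) ∷ (λ ()) ∷ [-]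
fWord²-square-free (ℓ ∷ [])       = (λ ()) ∷ [-]
fWord²-square-free (l0 ∷ l0 ∷ w)  = (λ ()) ∷ (λ ()) ∷ (λ ()) ∷ (λ ()) ∷ (λ ()) ∷ (λ ()) ∷ fWord²-square-free (l0 ∷ w)
fWord²-square-free (l0 ∷ l1 ∷ w)  = (λ ()) ∷ (λ ()) ∷ (λ ()) ∷ (λ ()) ∷ (λ ()) ∷ (λ ()) ∷ fWord²-square-free (l1 ∷ w)
fWord²-square-free (l0 ∷ ℓ ∷ w)   = (λ ()) ∷ (λ ()) ∷ (λ ()) ∷ (λ ()) ∷ (λ ()) ∷ (λ ()) ∷ fWord²-square-free (ℓ ∷ w)
fWord²-square-free (l1 ∷ l0 ∷ w)  = (λ ()) ∷ (λ ()) ∷ (λ ()) ∷ (λ ()) ∷ fWord²-square-free (l0 ∷ w)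
fWord²-square-free (l1 ∷ l1 ∷ w)  = (λ ()) ∷ (λ ()) ∷ (λ ()) ∷ (λ ()) ∷ fWord²-square-free (l1 ∷ w)
fWord²-square-free (l1 ∷ ℓ ∷ w)   = (λ ()) ∷ (λ ()) ∷ (λ ()) ∷ (λ ()) ∷ fWord²-square-free (ℓ ∷ w)
fWord²-square-free (ℓ ∷ l0 ∷ w)   = (λ ()) ∷ (λ ()) ∷ fWord²-square-free (l0 ∷ w)
fWord²-square-free (ℓ ∷ l1 ∷ w)   = (λ ()) ∷ (λ ()) ∷ fWord²-square-free (l1 ∷ w)
fWord²-square-free (ℓ ∷ ℓ ∷ w)    = (λ ()) ∷ (λ ()) ∷ fWord²-square-free (ℓ ∷ w)

iter-square-free : ∀ K → Linked _≢_ (iter K)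
iter-square-free zero          = [-]
iter-square-free (suc zero)    = (λ ()) ∷ (λ ()) ∷ [-]
iter-square-free (suc (suc K)) = fWord²-square-free (iter K)

Linked-Infix-pair : ∀ {A : Set} {R : A → A → Set} {a b : A} {w} →
                    Infix (a ∷ b ∷ []) w → Linked R w → R a b
Linked-Infix-pair ([]    , s , refl) (Rab ∷ _) = Rab
Linked-Infix-pair (_ ∷ p , s , refl) linked    = Linked-Infix-pair (p , s , refl) (Linked.tail linked)

short-Infix-iter : ∀ {u K} → length u ≤ 2 → Infix u (iter K) → Infix u (iter 3)
short-Infix-iter {[]}             _ _   = [] , iter 3 , refl
short-Infix-iter {l0 ∷ []}        _ _   = [] , _ , refl
short-Infix-iter {l1 ∷ []}        _ _   = l0 ∷ [] , _ , refl
short-Infix-iter {ℓ ∷ []}         _ _   = l0 ∷ l1 ∷ [] , _ , refl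
short-Infix-iter {a ∷ b ∷ []} {K} _ occ = distinct-pair a b (Linked-Infix-pair occ (iter-square-free K))
  where
  distinct-pair : ∀ a b → a ≢ b → Infix (a ∷ b ∷ []) (iter 3)
  distinct-pair l0 l0 a≢b = ⊥-elim (a≢b refl)
  distinct-pair l1 l1 a≢b = ⊥-elim (a≢b refl)
  distinct-pair ℓ  ℓ  a≢b = ⊥-elim (a≢b refl)
  distinct-pair l0 l1 _   = [] , _ , refl
  distinct-pair l1 ℓ  _   = l0 ∷ [] , _ , refl
  distinct-pair ℓ  l0 _   = l0 ∷ l1 ∷ [] , _ , refl
  distinct-pair l0 ℓ  _   = l0 ∷ l1 ∷ ℓ ∷ [] , _ , refl
  distinct-pair ℓ  l1 _   = l0 ∷ l1 ∷ ℓ ∷ l0 ∷ [] , _ , refl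
  distinct-pair l1 l0 _   = l0 ∷ l1 ∷ ℓ ∷ l0 ∷ ℓ ∷ [] , _ , refl
short-Infix-iter {_ ∷ _ ∷ _ ∷ _} (s≤s (s≤s ())) _

fWord²-long : ∀ a → 2 ≤ length (fWord (f a))
fWord²-long l0 = s≤s (s≤s z≤n)
fWord²-long l1 = s≤s (s≤s z≤n)
fWord²-long ℓ  = s≤s (s≤s z≤n)

fWord²≡concatMap : ∀ w → fWord (fWord w) ≡ concatMap (fWord ∘ f) w
fWord²≡concatMap = concatMap-concatMap f f

half-< : ∀ {k m} → 3 ≤ m → 2 * k ≤ m + 2 → k < m
half-< {k} {m} 3≤m 2k≤ = *-cancelˡ-< 2 k m (begin-strict
  2 * k          ≤⟨ 2k≤ ⟩
  m + 2          <⟨ +-monoʳ-< m 3≤m ⟩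
  m + m          ≡⟨ cong (m +_) (+-identityʳ m) ⟨
  2 * m          ∎)
  where open ≤-Reasoning

-- depth n = 2n + 3, written so that iter (depth (suc n)) is f²(iter (depth n)) by definition.
depth : ℕ → ℕ
depth zero    = 3
depth (suc n) = suc (suc (depth n))

3≤depth : ∀ n → 3 ≤ depth n
3≤depth zero    = ≤-refl
3≤depth (suc n) = m≤n⇒m≤1+n (m≤n⇒m≤1+n (3≤depth n))

Infix-iter-depth : ∀ n {u K} → length u ≤ n → Infix u (iter K) → Infix u (iter (depth n))
Infix-iter-depth n {u} {K} u≤n occ with length u ≤? 2
... | yes short = Infix-trans (short-Infix-iter {K = K} short occ) (Prefix⇒Infix (iter-Prefix (3≤depth n)))
Infix-iter-depth zero    u≤n occ | no long = ⊥-elim (long (≤-trans u≤n z≤n))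
Infix-iter-depth (suc n) {u} {K} u≤n occ | no long
  with Infix-trans occ (Prefix⇒Infix (iter-Prefix (m≤n+m K 2)))
... | p , s , e
  with Desubstitution.infix-cover (fWord ∘ f) fWord²-long (iter K) p u s
         (trans (sym (fWord²≡concatMap (iter K))) e)
... | v , v⊑iterK , u⊑v² , 2v≤u+2 =
  Infix-trans (subst (Infix u) (sym (fWord²≡concatMap v)) u⊑v²)
              (fWord-Infix (fWord-Infix (Infix-iter-depth n {K = K} v≤n v⊑iterK)))
  where
  v≤n : length v ≤ n
  v≤n = ≤-pred (<-≤-trans (half-< (≰⇒> long) 2v≤u+2) u≤n)

factor-occurs-early : ∀ n i → ∃[ j ] j < suc (length (iter (depth n))) × factor vtm i n ≡ factor vtm j n
factor-occurs-early n i
  with Infix-iter⇒vtm-factor {K = depth n}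
         (Infix-iter-depth n {K = suc (i + n)} (≤-reflexive (length-factor vtm i n)) (vtm-factor-in-iter i n))
... | j , j≤ , same = j , s≤s j≤ ,
  sym (subst (λ m → factor vtm j m ≡ factor vtm i n) (length-factor vtm i n) same)

data Turn : Set where
  turn0 turnℓ : Turn

-- The letters 0 and λ of the word alternate, and the turn says which of them comes next.
data Alternating : Turn → List Letter → Set where
  []   : ∀ {t} → Alternating t []
  1∷_  : ∀ {t w} → Alternating t w → Alternating t (l1 ∷ w)
  0∷_  : ∀ {w} → Alternating turnℓ w → Alternating turn0 (l0 ∷ w)
  ℓ∷_  : ∀ {w} → Alternating turn0 w → Alternating turnℓ (ℓ ∷ w)

fWord-Alternating : ∀ w → Alternating turn0 (fWord w)
fWord-Alternating []       = []
fWord-Alternating (l0 ∷ w) = 0∷ 1∷ ℓ∷ fWord-Alternating w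
fWord-Alternating (l1 ∷ w) = 0∷ ℓ∷ fWord-Alternating w
fWord-Alternating (ℓ ∷ w)  = 1∷ fWord-Alternating w

Alternating-suffix : ∀ {t} p {w} → Alternating t (p ++ w) → ∃[ t′ ] Alternating t′ w
Alternating-suffix []      alt      = _ , alt
Alternating-suffix (_ ∷ p) (1∷ alt) = Alternating-suffix p alt
Alternating-suffix (_ ∷ p) (0∷ alt) = Alternating-suffix p alt
Alternating-suffix (_ ∷ p) (ℓ∷ alt) = Alternating-suffix p alt

Alternating-prefix : ∀ {t} u {s} → Alternating t (u ++ s) → Alternating t u
Alternating-prefix []      _        = []
Alternating-prefix (_ ∷ u) (1∷ alt) = 1∷ Alternating-prefix u alt
Alternating-prefix (_ ∷ u) (0∷ alt) = 0∷ Alternating-prefix u alt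
Alternating-prefix (_ ∷ u) (ℓ∷ alt) = ℓ∷ Alternating-prefix u alt

Alternating-Infix : ∀ {t u w} → Infix u w → Alternating t w → ∃[ t′ ] Alternating t′ u
Alternating-Infix {u = u} (p , s , refl) alt = map₂ (Alternating-prefix u) (Alternating-suffix p alt)

Balanced : List Letter → Set
Balanced u = count l0 u ≤ suc (count ℓ u) × count ℓ u ≤ suc (count l0 u)

OneAhead : ℕ → ℕ → Set
OneAhead x y = y ≤ x × x ≤ suc y

Leads : Turn → List Letter → Set
Leads turn0 u = OneAhead (count l0 u) (count ℓ u)
Leads turnℓ u = OneAhead (count ℓ u) (count l0 u)

OneAhead-swap : ∀ {x y} → OneAhead x y → OneAhead (suc y) x
OneAhead-swap (y≤x , x≤1+y) = x≤1+y , s≤s y≤x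

OneAhead⇒close : ∀ {x y} → OneAhead x y → x ≤ suc y × y ≤ suc x
OneAhead⇒close (y≤x , x≤1+y) = x≤1+y , m≤n⇒m≤1+n y≤x

Alternating-Leads : ∀ {t u} → Alternating t u → Leads t u
Alternating-Leads {turn0} []        = z≤n , z≤n
Alternating-Leads {turnℓ} []        = z≤n , z≤n
Alternating-Leads {turn0} (1∷ alt)  = Alternating-Leads alt
Alternating-Leads {turnℓ} (1∷ alt)  = Alternating-Leads alt
Alternating-Leads         (0∷ alt)  = OneAhead-swap (Alternating-Leads alt)
Alternating-Leads         (ℓ∷ alt)  = OneAhead-swap (Alternating-Leads alt)

Alternating⇒Balanced : ∀ {t u} → Alternating t u → Balanced u
Alternating⇒Balanced {turn0} alt = OneAhead⇒close (Alternating-Leads alt)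
Alternating⇒Balanced {turnℓ} alt = swap (OneAhead⇒close (Alternating-Leads alt))

vtm-factor-Balanced : ∀ i n → Balanced (factor vtm i n)
vtm-factor-Balanced i n = Alternating⇒Balanced (proj₂
  (Alternating-Infix (vtm-factor-in-iter i n) (fWord-Alternating (iter (i + n)))))

length-counts : ∀ u → length u ≡ count l0 u + count l1 u + count ℓ u
length-counts []       = refl
length-counts (l0 ∷ u) = cong suc (length-counts u)
length-counts (l1 ∷ u) = trans (cong suc (length-counts u))
                               (cong (_+ count ℓ u) (sym (+-suc (count l0 u) (count l1 u))))
length-counts (ℓ ∷ u)  = trans (cong suc (length-counts u)) (sym (+-suc (count l0 u + count l1 u) (count ℓ u)))

-- a, b, c count the letters 0, 1, λ of one word, and a′, b′, c′ those of the other.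
surplus-transfer : ∀ {lam a b c a′ b′ c′} d → c + d ≡ c′ →
  a + b + c ≡ a′ + b′ + c′ → b + lam * c ≡ b′ + lam * c′ → a + lam * d ≡ a′ + d
surplus-transfer {lam} {a} {b} {c} {a′} {b′} d refl same-length same-weight =
  +-cancelʳ-≡ (b′ + c) (a + lam * d) (a′ + d) (begin
    a + lam * d + (b′ + c)     ≡⟨ regroupˡ a lam d b′ c ⟩
    a + (b′ + lam * d) + c     ≡⟨ cong (λ z → a + z + c) b≡ ⟨
    a + b + c                  ≡⟨ same-length ⟩
    a′ + b′ + (c + d)          ≡⟨ regroupʳ a′ b′ c d ⟩
    a′ + d + (b′ + c)          ∎)
  where
  open ≡-Reasoning
  regroupˡ : ∀ a lam d b′ c → a + lam * d + (b′ + c) ≡ a + (b′ + lam * d) + c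
  regroupˡ = solve-∀
  regroupʳ : ∀ a′ b′ c d → a′ + b′ + (c + d) ≡ a′ + d + (b′ + c)
  regroupʳ = solve-∀
  split-weight : ∀ b′ lam c d → b′ + lam * (c + d) ≡ b′ + lam * d + lam * c
  split-weight = solve-∀
  b≡ : b ≡ b′ + lam * d
  b≡ = +-cancelʳ-≡ (lam * c) b (b′ + lam * d) (trans same-weight (split-weight b′ lam c d))

surplus-too-large : ∀ {lam a a′ c} d → 5 ≤ lam → a + lam * suc d ≡ a′ + suc d →
                    c ≤ suc a → a′ ≤ suc (suc c + d) → ⊥
surplus-too-large {lam} {a} {a′} {c} d 5≤lam zeros c≤1+a a′≤ =
  m+1+n≰m bound (begin
    bound + suc (3 * d)      ≡⟨ slack c d ⟩
    5 * suc d + c            ≤⟨ +-monoˡ-≤ c (*-monoˡ-≤ (suc d) 5≤lam) ⟩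
    lam * suc d + c          ≤⟨ +-monoʳ-≤ (lam * suc d) c≤1+a ⟩
    lam * suc d + suc a      ≡⟨ +-comm (lam * suc d) (suc a) ⟩
    suc (a + lam * suc d)    ≡⟨ cong suc zeros ⟩
    suc (a′ + suc d)         ≤⟨ s≤s (+-monoˡ-≤ (suc d) a′≤) ⟩
    bound                    ∎)
  where
  open ≤-Reasoning
  bound : ℕ
  bound = suc (suc (suc c + d) + suc d)
  slack : ∀ c d → suc (suc (suc c + d) + suc d) + suc (3 * d) ≡ 5 * suc d + c
  slack = solve-∀

count-ℓ-≤ : ∀ {lam a b c a′ b′ c′} → 5 ≤ lam → c ≤ suc a → a′ ≤ suc c′ →
            a + b + c ≡ a′ + b′ + c′ → b + lam * c ≡ b′ + lam * c′ → c′ ≤ c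
count-ℓ-≤ {lam} {a} {b} {c} {c′ = c′} 5≤lam c≤1+a a′≤1+c′ same-length same-weight with c′ ≤? c
... | yes c′≤c = c′≤c
... | no c′≰c with m≤n⇒∃[o]m+o≡n (≰⇒> c′≰c)
...   | d , refl = ⊥-elim (surplus-too-large d 5≤lam
          (surplus-transfer {lam} {a} {b} (suc d) (+-suc c d) same-length same-weight) c≤1+a a′≤1+c′)

additive⇒abelian : ∀ {lam} u v → 5 ≤ lam → Balanced u → Balanced v → AddEq lam u v → AbEq u v
additive⇒abelian {lam} u v 5≤lam (u0≤ , uℓ≤) (v0≤ , vℓ≤) (same-length , same-weight) = abelian
  where
  same-counts : count l0 u + count l1 u + count ℓ u ≡ count l0 v + count l1 v + count ℓ v
  same-counts = trans (sym (length-counts u)) (trans same-length (length-counts v))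
  same-ℓ : count ℓ u ≡ count ℓ v
  same-ℓ = ≤-antisym (count-ℓ-≤ 5≤lam vℓ≤ u0≤ (sym same-counts) (sym same-weight))
                     (count-ℓ-≤ 5≤lam uℓ≤ v0≤ same-counts same-weight)
  same-1 : count l1 u ≡ count l1 v
  same-1 = +-cancelʳ-≡ (lam * count ℓ u) _ _ (trans same-weight (cong (λ z → count l1 v + lam * z) (sym same-ℓ)))
  same-0 : count l0 u ≡ count l0 v
  same-0 = +-cancelʳ-≡ (count l1 u) _ _ (+-cancelʳ-≡ (count ℓ u) _ _
             (trans same-counts (cong₂ (λ y z → count l0 v + y + z) (sym same-1) (sym same-ℓ))))
  abelian : AbEq u v
  abelian l0 = same-0
  abelian l1 = same-1
  abelian ℓ  = same-ℓ

abelian⇒additive : ∀ lam u v → AbEq u v → AddEq lam u v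
abelian⇒additive lam u v same =
  trans (length-counts u) (trans (cong₂ _+_ (cong₂ _+_ (same l0) (same l1)) (same ℓ)) (sym (length-counts v))) ,
  cong₂ _+_ (same l1) (cong (lam *_) (same ℓ))

AbEq? : ∀ u v → Dec (AbEq u v)
AbEq? u v with count l0 u ≟ count l0 v | count l1 u ≟ count l1 v | count ℓ u ≟ count ℓ v
... | yes e0 | yes e1 | yes eℓ = yes λ { l0 → e0 ; l1 → e1 ; ℓ → eℓ }
... | no ¬e0 | _      | _      = no λ same → ¬e0 (same l0)
... | yes _  | no ¬e1 | _      = no λ same → ¬e1 (same l1)
... | yes _  | yes _  | no ¬eℓ = no λ same → ¬eℓ (same ℓ)

module Classes {R : List Letter → List Letter → Set}
               (R? : ∀ u v → Dec (R u v)) (R-refl : ∀ {u} → R u u) (R-sym : ∀ {u v} → R u v → R v u)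
               (x : ℕ → Letter) (n : ℕ) where

  _~_ : ℕ → ℕ → Set
  i ~ j = R (factor x i n) (factor x j n)

  Representatives : ℕ → Set
  Representatives L = ∃[ k ] Σ[ pos ∈ (Fin k → ℕ) ]
    (∀ p q → pos p ~ pos q → p ≡ q) × (∀ i → i < L → ∃[ p ] i ~ pos p)

  covers-suc : ∀ {k L} {pos : Fin k → ℕ} → (∀ i → i < L → ∃[ p ] i ~ pos p) →
               ∃[ p ] L ~ pos p → ∀ i → i < suc L → ∃[ p ] i ~ pos p
  covers-suc covers hit i i<1+L with m<1+n⇒m<n∨m≡n i<1+L
  ... | inj₁ i<L  = covers i i<L
  ... | inj₂ refl = hit

  representatives : ∀ L → Representatives L
  representatives zero = 0 , (λ ()) , (λ ()) , (λ _ ())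
  representatives (suc L) with representatives L
  ... | k , pos , distinct , covers with any? (λ p → R? (factor x L n) (factor x (pos p) n))
  ...   | yes hit  = k , pos , distinct , covers-suc covers hit
  ...   | no  miss = suc k , pos′ , distinct′ ,
                     covers-suc {pos = pos′} (λ i i<L → shift (covers i i<L)) (zero , R-refl)
    where
    pos′ : Fin (suc k) → ℕ
    pos′ zero    = L
    pos′ (suc p) = pos p
    distinct′ : ∀ p q → pos′ p ~ pos′ q → p ≡ q
    distinct′ zero    zero    _ = refl
    distinct′ zero    (suc q) r = ⊥-elim (miss (q , r))
    distinct′ (suc p) zero    r = ⊥-elim (miss (p , R-sym r))
    distinct′ (suc p) (suc q) r = cong suc (distinct p q r)
    shift : ∀ {i} → ∃[ p ] i ~ pos p → ∃[ p ] i ~ pos′ p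
    shift (p , r) = suc p , r

  numClasses-of-window : ∀ L → (∀ i → ∃[ j ] j < L × factor x i n ≡ factor x j n) → ∃[ k ] NumClasses R x n k
  numClasses-of-window L window with representatives L
  ... | k , pos , distinct , covers = k , pos , distinct , covers-all
    where
    covers-all : ∀ i → ∃[ p ] i ~ pos p
    covers-all i with window i
    ... | j , j<L , same with covers j j<L
    ...   | p , r = p , subst (λ w → R w (factor x (pos p) n)) (sym same) r

NumClasses-map : ∀ {R S} x n {k} →
  (∀ i j → R (factor x i n) (factor x j n) → S (factor x i n) (factor x j n)) →
  (∀ i j → S (factor x i n) (factor x j n) → R (factor x i n) (factor x j n)) →
  NumClasses R x n k → NumClasses S x n k
NumClasses-map x n R⇒S S⇒R (pos , distinct , covers) =
  pos , (λ p q → distinct p q ∘ S⇒R (pos p) (pos q)) , (λ i → map₂ (R⇒S i _) (covers i))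

theorem5p1 : (lam : ℕ) → 5 ≤ lam → (n : ℕ) →
    Σ ℕ (λ k → NumClasses (AddEq lam) vtm n k × NumClasses AbEq vtm n k)
theorem5p1 lam 5≤lam n
  with Classes.numClasses-of-window AbEq? (λ _ → refl) (λ same a → sym (same a)) vtm n _ (factor-occurs-early n)
... | k , abelian = k , NumClasses-map {AbEq} {AddEq lam} vtm n additive abelian′ abelian , abelian
  where
  additive : ∀ i j → AbEq (factor vtm i n) (factor vtm j n) → AddEq lam (factor vtm i n) (factor vtm j n)
  additive i j = abelian⇒additive lam (factor vtm i n) (factor vtm j n)
  abelian′ : ∀ i j → AddEq lam (factor vtm i n) (factor vtm j n) → AbEq (factor vtm i n) (factor vtm j n)
  abelian′ i j = additive⇒abelian (factor vtm i n) (factor vtm j n) 5≤lam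
                   (vtm-factor-Balanced i n) (vtm-factor-Balanced j n)
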